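{- For every graph structure $\Gamma:\Omega\to S^{<\omega}$ there exists a monograph $T$ such that $\mathrm{S}(T)$ and $\Gamma$ are isomorphic in the category $\mathbf{Sig}_S$, i.e. there is a bijection $r_\Omega:\Omega_T\to\Omega$ with $\mathrm{E}_T=S$ and $\Gamma\circ r_\Omega=\mathrm{S}(T)$.
   Context: A monograph is a set $T$ of ordered pairs which is a functional relation with domain some set $\mathrm{E}_T$ (the edges) such that each $T(e)$ is a function $\lambda\to\mathrm{E}_T$ for some ordinal $\lambda=|e|$; $e_\iota$ denotes $T(e)(\iota)$. A signature is a function $\Sigma:\Omega\to S^{<\omega}$ (finite sequences of sorts from $S$) with $\Sigma(o)$ nonempty for all $o$; for $o$ with $\Sigma(o)$ of length $n+1$, its range is the last entry and its domain the first $n$ entries; $o$ is monadic if $n=1$, and $\Sigma$ is a graph structure if all its operator names are monadic. A morphism of signatures $\Sigma\to\Sigma'$ (with $\Sigma':\Omega'\to S'^{<\omega}$) is a pair $\langle r_\Omega,r_S\rangle$ of functions $r_\Omega:\Omega\to\Omega'$, $r_S:S\to S'$ with $\Sigma'(r_\Omega(o))=r_S\circ\Sigma(o)$ for all $o\in\Omega$. $\mathbf{Sig}_S$ is the subcategory of signatures with only those morphisms whose sort component $r_S$ is a canonical inclusion map. For a monograph $T$, $\Omega_T=\{[e,\iota]: e\in\mathrm{E}_T,\ \iota<|e|\}$ (formal operator names) and $\mathrm{S}(T):\Omega_T\to\mathrm{E}_T^{<\omega}$ is the graph structure with $\mathrm{S}(T)([e,\iota])=e\,e_\iota$ (domain sort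 $e$, range sort $e_\iota$). The proof may use the Axiom of Choice. -}

module Defs where

open import Level using (0ℓ)
open import Data.Nat using (ℕ)
open import Data.List using (List; []; _∷_; length)
open import Data.Product using (Σ; _×_; _,_)
open import Relation.Binary.Core using (Rel)
open import Relation.Binary.Structures using (IsStrictTotalOrder)
open import Relation.Binary.PropositionalEquality using (_≡_; _≢_)
open import Induction.WellFounded using (WellFounded)
open import Function.Definitions using (Bijective)

record IsWellOrder {A : Set} (_<_ : Rel A 0ℓ) : Set where
  field
    isStrictTotalOrder : IsStrictTotalOrder _≡_ _<_
    wellFounded        : WellFounded _<_

-- Ordinals, rendered type-theoretically as well-ordered types.
-- An element of Carrier λ plays the role of an ordinal ι < λ.
record Ordinal : Set₁ where
  field
    Carrier : Set
    _<_     : Rel Carrier 0ℓ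
    isWellOrder : IsWellOrder _<_
open Ordinal public

-- Well-ordering theorem (equivalent to the Axiom of Choice), which the
-- paper's proof is allowed to use; it is taken as a hypothesis.
WellOrderingTheorem : Set₁
WellOrderingTheorem = (A : Set) → Σ (Rel A 0ℓ) IsWellOrder

IsSignature : {Ω S : Set} → (Ω → List S) → Set
IsSignature Γ = ∀ o → Γ o ≢ []

IsMonadic : {Ω S : Set} → (Ω → List S) → Ω → Set
IsMonadic Γ o = length (Γ o) ≡ 2

IsGraphStructure : {Ω S : Set} → (Ω → List S) → Set
IsGraphStructure Γ = IsSignature Γ × (∀ o → IsMonadic Γ o)

record Monograph (E : Set) : Set₁ where
  field
    len  : E → Ordinal
    comp : (e : E) → Carrier (len e) → E
open Monograph public

Ops : {E : Set} → Monograph E → Set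
Ops {E} T = Σ E (λ e → Carrier (len T e))

Sig : {E : Set} (T : Monograph E) → Ops T → List E
Sig T (e , ι) = e ∷ comp T e ι ∷ []

-- Isomorphism S(T) ≅ Γ in Sig_S (sort component the identity on S = E_T):
-- a bijection r_Ω : Ω_T → Ω with Γ ∘ r_Ω = S(T).
IsoInSigS : {Ω S : Set} (T : Monograph S) (Γ : Ω → List S) → Set
IsoInSigS {Ω} T Γ = Σ (Ops T → Ω) (λ r → Bijective _≡_ _≡_ r × (∀ x → Γ (r x) ≡ Sig T x))

{-# OPTIONS --safe #-}
module Submission where

open import Defs
open import Data.List using (List; []; _∷_; length)
open import Data.Product using (Σ; _,_; proj₁; proj₂)
open import Function.Definitions using (Bijective)
open import Relation.Binary.PropositionalEquality using (_≡_; refl; sym; trans)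

-- The monograph has one edge per sort, whose components are the operators out of it
-- (well-ordered by the hypothesis); the formal operator [e, o] then is just o.

length≡2⇒pair : {A : Set} (l : List A) → length l ≡ 2 →
                Σ A (λ a → Σ A (λ b → l ≡ a ∷ b ∷ []))
length≡2⇒pair (a ∷ b ∷ []) refl = a , b , refl

wellOrdered : WellOrderingTheorem → Set → Ordinal
wellOrdered wot A = record
  { Carrier = A ; _<_ = proj₁ (wot A) ; isWellOrder = proj₂ (wot A) }

Fibre : {A B : Set} → (A → B) → B → Set
Fibre {A} f b = Σ A (λ a → f a ≡ b)

fibre-point : {A B : Set} (f : A → B) → Σ B (Fibre f) → A
fibre-point f (_ , a , _) = a

fibre-point-bijective : {A B : Set} (f : A → B) → Bijective _≡_ _≡_ (fibre-point f)
fibre-point-bijective f = injective , surjective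
  where
  injective : ∀ {x y} → fibre-point f x ≡ fibre-point f y → x ≡ y
  injective {_ , a , refl} {_ , .a , refl} refl = refl

  surjective : ∀ a → Σ _ (λ x → ∀ {z} → z ≡ x → fibre-point f z ≡ a)
  surjective a = (f a , a , refl) , λ { refl → refl }

module _ {Ω S : Set} (src tgt : Ω → S) where

  graphMonograph : WellOrderingTheorem → Monograph S
  graphMonograph wot = record
    { len  = λ e → wellOrdered wot (Fibre src e)
    ; comp = λ _ (o , _) → tgt o
    }

  Sig-graphMonograph : (wot : WellOrderingTheorem) (x : Ops (graphMonograph wot)) →
                       let o = fibre-point src x in
                       Sig (graphMonograph wot) x ≡ src o ∷ tgt o ∷ []
  Sig-graphMonograph wot (_ , _ , refl) = refl

lemma11 : WellOrderingTheorem → (Ω S : Set) (Γ : Ω → List S) → IsGraphStructure Γ →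
    Σ (Monograph S) (λ T → IsoInSigS T Γ)
lemma11 wot Ω S Γ (_ , monadic) =
  graphMonograph src tgt wot , fibre-point src , fibre-point-bijective src , commutes
  where
  endpoints : ∀ o → Σ S (λ a → Σ S (λ b → Γ o ≡ a ∷ b ∷ []))
  endpoints o = length≡2⇒pair (Γ o) (monadic o)

  src tgt : Ω → S
  src o = proj₁ (endpoints o)
  tgt o = proj₁ (proj₂ (endpoints o))

  commutes : ∀ x → Γ (fibre-point src x) ≡ Sig (graphMonograph src tgt wot) x
  commutes x = trans (proj₂ (proj₂ (endpoints (fibre-point src x))))
                     (sym (Sig-graphMonograph src tgt wot x))
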